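{- Let $G=(V,E)$ be a hypergraph with $|V|\ge2$ whose hyperedge set is pairwise intersecting. Then for every $F\subseteq E$, the hypergraph $G-F=(V,E\setminus F)$ is disconnected if and only if there is a vertex $v\in V$ such that every hyperedge $e\in E$ with $v\in e$ and $e\neq\{v\}$ belongs to $F$ (i.e., the degree cut of $v$ fails).
   Context: A set of hyperedges is pairwise intersecting if any two hyperedges in it share at least one vertex. A hypergraph is disconnected if there is a bipartition of its vertex set into two nonempty parts such that every hyperedge lies entirely within one part. The degree cut of a vertex $v$ is the set of hyperedges containing $v$ and at least one other vertex; it fails if all its hyperedges are deleted. -}

module Defs where

open import Data.Nat using (ℕ)
open import Data.Fin using (Fin)
open import Data.Fin.Subset using (Subset; _∈_; _∉_; _⊆_; ∁; Nonempty; ⁅_⁆)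
open import Data.Product using (Σ; ∃; _×_; _,_)
open import Data.Sum using (_⊎_)
open import Relation.Binary.PropositionalEquality using (_≡_; _≢_)
open import Function.Definitions using (Injective)

-- Each hyperedge is a nonempty subset of the vertices; distinct indices give
-- distinct hyperedges (so the family is a genuine set of hyperedges).
record Hypergraph (n m : ℕ) : Set where
  field
    edge      : Fin m → Subset n
    nonempty  : ∀ i → Nonempty (edge i)
    distinct  : Injective _≡_ _≡_ edge
open Hypergraph public

PairwiseIntersecting : ∀ {n m} → Hypergraph n m → Set
PairwiseIntersecting {n} {m} G =
  ∀ (i j : Fin m) → i ≢ j → ∃ λ (v : Fin n) → v ∈ edge G i × v ∈ edge G j

-- G - F is disconnected, where F ⊆ E is given as a set of hyperedge indices:
-- a bipartition (S, ∁ S) of V into nonempty parts such that every hyperedge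
-- not in F lies entirely inside S or entirely inside ∁ S.
DisconnectedMinus : ∀ {n m} → Hypergraph n m → Subset m → Set
DisconnectedMinus {n} {m} G F =
  Σ (Subset n) λ S → Nonempty S × Nonempty (∁ S) ×
    (∀ (i : Fin m) → i ∉ F → (edge G i ⊆ S) ⊎ (edge G i ⊆ ∁ S))

DegreeCutFails : ∀ {n m} → Hypergraph n m → Subset m → Fin n → Set
DegreeCutFails {n} {m} G F v =
  ∀ (i : Fin m) → v ∈ edge G i → edge G i ≢ ⁅ v ⁆ → i ∈ F

{-# OPTIONS --safe #-}
module Submission where

-- If G − F is split by S, a surviving edge through a vertex of S lies in S and one through a
-- vertex of ∁ S lies in ∁ S; two such edges would be disjoint, which pairwise intersection
-- forbids. So for a ∈ S and b ∈ ∁ S, either a or b lies on no surviving edge at all.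
-- Conversely, if the degree cut of v fails, then ⁅ v ⁆ is the only surviving edge through v,
-- so ⁅ v ⁆ and its complement separate G − F.

open import Defs
open import Data.Nat using (ℕ; _≤_; s≤s)
open import Data.Fin using (Fin; zero; _≟_; punchIn)
open import Data.Fin.Properties using (any?; punchInᵢ≢i)
open import Data.Fin.Subset using (Subset; _∈_; _∉_; _⊆_; ∁; Nonempty; ⁅_⁆)
open import Data.Fin.Subset.Properties
  using (_∈?_; ⊆-reflexive; x∈⁅x⁆; x∈⁅y⁆⇒x≡y; x∈∁p⇒x∉p; x∉p⇒x∈∁p)
open import Data.Bool using () renaming (_≟_ to _≟ᵇ_)
open import Data.Vec.Properties using (≡-dec)
open import Data.Product using (∃; _,_)
open import Data.Sum using (_⊎_; inj₁; inj₂)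
open import Function using (_∘_)
open import Function.Bundles using (_⇔_; mk⇔)
open import Relation.Nullary using (yes; no; ¬_; contradiction)
open import Relation.Nullary.Decidable using (¬?; _×-dec_; decidable-stable)
open import Relation.Binary.PropositionalEquality using (refl; subst)

private
  variable
    n m : ℕ

Separates : Hypergraph n m → Subset m → Subset n → Set
Separates {m = m} G F S = ∀ (i : Fin m) → i ∉ F → edge G i ⊆ S ⊎ edge G i ⊆ ∁ S

Isolated : Hypergraph n m → Subset m → Fin n → Set
Isolated G F v = ∀ i → v ∈ edge G i → i ∈ F

∁⁅x⁆-nonempty : 2 ≤ n → (v : Fin n) → Nonempty (∁ ⁅ v ⁆)
∁⁅x⁆-nonempty (s≤s (s≤s _)) v =
  punchIn v zero , x∉p⇒x∈∁p (punchInᵢ≢i v zero ∘ x∈⁅y⁆⇒x≡y v)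

module _ (G : Hypergraph n m) where

  Isolated⇒DegreeCutFails : ∀ {F v} → Isolated G F v → DegreeCutFails G F v
  Isolated⇒DegreeCutFails isolated i v∈i _ = isolated i v∈i

  PairwiseIntersecting⇒¬split : PairwiseIntersecting G → ∀ {S i j} →
    edge G i ⊆ S → ¬ edge G j ⊆ ∁ S
  PairwiseIntersecting⇒¬split intersecting {i = i} {j} i⊆S j⊆∁S with i ≟ j
  ... | yes refl with nonempty G i
  ...   | x , x∈i = x∈∁p⇒x∉p (j⊆∁S x∈i) (i⊆S x∈i)
  PairwiseIntersecting⇒¬split intersecting {i = i} {j} i⊆S j⊆∁S
      | no i≢j with intersecting i j i≢j
  ...   | x , x∈i , x∈j = x∈∁p⇒x∉p (j⊆∁S x∈j) (i⊆S x∈i)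

  module _ {F : Subset m} {S : Subset n} (separates : Separates G F S) where

    surviving-edge⊆S : ∀ {i v} → i ∉ F → v ∈ edge G i → v ∈ S → edge G i ⊆ S
    surviving-edge⊆S {i} i∉F v∈i v∈S with separates i i∉F
    ... | inj₁ i⊆S  = i⊆S
    ... | inj₂ i⊆∁S = contradiction v∈S (x∈∁p⇒x∉p (i⊆∁S v∈i))

    surviving-edge⊆∁S : ∀ {i v} → i ∉ F → v ∈ edge G i → v ∈ ∁ S → edge G i ⊆ ∁ S
    surviving-edge⊆∁S {i} i∉F v∈i v∈∁S with separates i i∉F
    ... | inj₁ i⊆S  = contradiction (i⊆S v∈i) (x∈∁p⇒x∉p v∈∁S)
    ... | inj₂ i⊆∁S = i⊆∁S

    Separates⇒Isolated : PairwiseIntersecting G → ∀ {a b} → a ∈ S → b ∈ ∁ S →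
      Isolated G F a ⊎ Isolated G F b
    Separates⇒Isolated intersecting {a} {b} a∈S b∈∁S
      with any? (λ i → ¬? (i ∈? F) ×-dec (a ∈? edge G i))
    ... | no ∄i = inj₁ λ i a∈i →
      decidable-stable (i ∈? F) λ i∉F → ∄i (i , i∉F , a∈i)
    ... | yes (i , i∉F , a∈i) = inj₂ λ j b∈j →
      decidable-stable (j ∈? F) λ j∉F →
        PairwiseIntersecting⇒¬split intersecting
          (surviving-edge⊆S i∉F a∈i a∈S) (surviving-edge⊆∁S j∉F b∈j b∈∁S)

  DisconnectedMinus⇒DegreeCutFails : PairwiseIntersecting G → ∀ {F} →
    DisconnectedMinus G F → ∃ (DegreeCutFails G F)
  DisconnectedMinus⇒DegreeCutFails intersecting (S , (a , a∈S) , (b , b∈∁S) , separates)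
    with Separates⇒Isolated separates intersecting a∈S b∈∁S
  ... | inj₁ a-isolated = a , Isolated⇒DegreeCutFails a-isolated
  ... | inj₂ b-isolated = b , Isolated⇒DegreeCutFails b-isolated

  DegreeCutFails⇒⁅x⁆-Separates : ∀ {F v} → DegreeCutFails G F v → Separates G F ⁅ v ⁆
  DegreeCutFails⇒⁅x⁆-Separates {F} {v} fails i i∉F with v ∈? edge G i
  ... | yes v∈i = inj₁ (⊆-reflexive
        (decidable-stable (≡-dec _≟ᵇ_ (edge G i) ⁅ v ⁆) (i∉F ∘ fails i v∈i)))
  ... | no v∉i = inj₂ λ x∈i → x∉p⇒x∈∁p λ x∈⁅v⁆ →
        v∉i (subst (_∈ edge G i) (x∈⁅y⁆⇒x≡y v x∈⁅v⁆) x∈i)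

  DegreeCutFails⇒DisconnectedMinus : 2 ≤ n → ∀ {F v} →
    DegreeCutFails G F v → DisconnectedMinus G F
  DegreeCutFails⇒DisconnectedMinus 2≤n {v = v} fails =
    ⁅ v ⁆ , (v , x∈⁅x⁆ v) , ∁⁅x⁆-nonempty 2≤n v , DegreeCutFails⇒⁅x⁆-Separates fails

lemma4p5 : ∀ {n m : ℕ} (G : Hypergraph n m) → 2 ≤ n → PairwiseIntersecting G →
    (F : Subset m) → DisconnectedMinus G F ⇔ (∃ λ (v : Fin n) → DegreeCutFails G F v)
lemma4p5 G 2≤n intersecting F = mk⇔
  (DisconnectedMinus⇒DegreeCutFails G intersecting)
  (λ (_ , fails) → DegreeCutFails⇒DisconnectedMinus G 2≤n fails)
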